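{- Let $G$ be the graph of a neighborhood sequence of a non-leaping sequence. For any two vertices $a<b$, every vertex $k$ on any shortest path from $a$ to $b$ satisfies $k\le b$.
   Context: A sequence of integers $q_1,\ldots,q_n$ ($n\ge 2$) is non-leaping if $q_1=0$, $q_2=1$, and $2\le q_k\le q_{k-1}+1$ for $k=3,\ldots,n$. Set $b_k=k-q_k+1$ for $k\ge 3$. A neighborhood sequence is $W_1=\varnothing$, $W_2=\{1\}$, and for $k\ge3$, $W_k=\{a_k\}\cup\{b_k,\ldots,k-1\}$ where $a_k\in W_{k-1}$ and $a_k<b_k$. Its graph has vertex set $\{1,\ldots,n\}$ and edges $\{i,k\}$ for $i\in W_k$. -}

module Defs where

open import Data.Nat using (ℕ; zero; suc; _+_; _∸_; _≤_; _<_)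
open import Data.Product using (_×_)
open import Data.Sum using (_⊎_)
open import Data.Empty using (⊥)
open import Relation.Binary.PropositionalEquality using (_≡_)

-- Sequences are indexed by ℕ, only entries with index in 1..n matter.

NonLeaping : ℕ → (ℕ → ℕ) → Set
NonLeaping n q =
  (q 1 ≡ 0) × (q 2 ≡ 1) ×
  (∀ k → 3 ≤ k → k ≤ n → (2 ≤ q k) × (q k ≤ q (k ∸ 1) + 1))

bIdx : (ℕ → ℕ) → ℕ → ℕ
bIdx q k = k + 1 ∸ q k

-- membership i ∈ W_k, for the neighborhood sequence determined by q and the
-- choices a_k (k ≥ 3):  W_1 = ∅, W_2 = {1}, W_k = {a_k} ∪ {b_k,…,k-1}
InW : (q a : ℕ → ℕ) → ℕ → ℕ → Set
InW q a zero i = ⊥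
InW q a (suc zero) i = ⊥
InW q a (suc (suc zero)) i = i ≡ 1
InW q a k@(suc (suc (suc _))) i = (i ≡ a k) ⊎ ((bIdx q k ≤ i) × (i < k))

IsNeighborhoodSeq : ℕ → (q a : ℕ → ℕ) → Set
IsNeighborhoodSeq n q a =
  ∀ k → 3 ≤ k → k ≤ n → InW q a (k ∸ 1) (a k) × (a k < bIdx q k)

Adj : ℕ → (q a : ℕ → ℕ) → ℕ → ℕ → Set
Adj n q a x y =
  (1 ≤ x) × (x ≤ n) × (1 ≤ y) × (y ≤ n) × (InW q a y x ⊎ InW q a x y)

data Walk (E : ℕ → ℕ → Set) : ℕ → ℕ → ℕ → Set where
  nil  : ∀ {x} → Walk E x x 0
  cons : ∀ {x y z l} → E x y → Walk E y z l → Walk E x z (suc l)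

data OnWalk {E : ℕ → ℕ → Set} (k : ℕ) : ∀ {x z l} → Walk E x z l → Set where
  here-nil  : OnWalk k (nil {x = k})
  here-cons : ∀ {y z l} {e : E k y} {w : Walk E y z l} → OnWalk k (cons e w)
  there     : ∀ {x y z l} {e : E x y} {w : Walk E y z l} →
              OnWalk k w → OnWalk k (cons e w)

IsShortest : {E : ℕ → ℕ → Set} {x z l : ℕ} → Walk E x z l → Set
IsShortest {E} {x} {z} {l} w = ∀ l' → Walk E x z l' → l ≤ l'

-- The clamp x ↦ min x v maps every edge of the graph to an edge or to a single
-- vertex: an edge {x, y} with x < v < y comes from x ∈ W_y, and following x = a_y
-- back through W_{y-1}, W_{y-2}, … until x lies in an interval [b_j, j) shows
-- x ∈ W_v, because b is non-decreasing (q_{k+1} ≤ q_k + 1). Hence a walk from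
-- u < v that reaches some k > v before ending at v clamps, up to its visit of k,
-- to a strictly shorter walk from u to v.
module Submission where

open import Defs
open import Data.Nat using (ℕ; zero; suc; _+_; _≤_; _<_; _≤′_; ≤′-refl; ≤′-step; z≤n; s≤s; _⊓_; _≤?_; _<?_)
open import Data.Nat.Properties
open import Data.Product using (_×_; _,_; proj₁; proj₂; ∃-syntax)
open import Data.Sum using (_⊎_; inj₁; inj₂; map; map₁; map₂)
open import Data.Empty using (⊥-elim)
open import Relation.Binary.PropositionalEquality using (_≡_; refl; sym; subst)
open import Relation.Nullary using (yes; no)

module _ {E : ℕ → ℕ → Set} where

  walk-prefix : ∀ {x z l k} {w : Walk E x z l} → OnWalk k w →
                ∃[ l₁ ] Walk E x k l₁ × (l₁ < l ⊎ k ≡ z)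
  walk-prefix here-nil = 0 , nil , inj₂ refl
  walk-prefix here-cons = 0 , nil , inj₁ (s≤s z≤n)
  walk-prefix (there {e = e} p) with walk-prefix p
  ... | l₁ , w₁ , r = suc l₁ , cons e w₁ , map₁ (λ l₁<l → s≤s l₁<l) r

  walk-map : ∀ {E′ : ℕ → ℕ → Set} (f : ℕ → ℕ) →
             (∀ {x y} → E x y → f x ≡ f y ⊎ E′ (f x) (f y)) →
             ∀ {x z l} → Walk E x z l → ∃[ l′ ] l′ ≤ l × Walk E′ (f x) (f z) l′
  walk-map f edge nil = 0 , z≤n , nil
  walk-map {E′} f edge {z = z} (cons e w) with edge e | walk-map f edge w
  ... | inj₁ fx≡fy | l′ , l′≤l , w′ =
    l′ , m≤n⇒m≤1+n l′≤l , subst (λ t → Walk E′ t (f z) l′) (sym fx≡fy) w′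
  ... | inj₂ e′    | l′ , l′≤l , w′ = suc l′ , s≤s l′≤l , cons e′ w′

InW-unfold : ∀ {q a y x} → 3 ≤ y → InW q a y x → (x ≡ a y) ⊎ ((bIdx q y ≤ x) × (x < y))
InW-unfold {y = suc (suc (suc _))} _ h = h
InW-unfold {y = suc (suc zero)} (s≤s (s≤s ())) _

InW-fromInterval : ∀ {q a v x} → 2 ≤ v → 1 ≤ x → x < v → (3 ≤ v → bIdx q v ≤ x) → InW q a v x
InW-fromInterval {v = suc (suc zero)} _ (s≤s z≤n) (s≤s (s≤s z≤n)) _ = refl
InW-fromInterval {v = suc (suc (suc _))} _ _ x<v b≤x = inj₂ (b≤x (s≤s (s≤s (s≤s z≤n))) , x<v)

module _ {n : ℕ} {q : ℕ → ℕ} (nl : NonLeaping n q) where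

  private
    q≥2 : ∀ {k} → 3 ≤ k → k ≤ n → 2 ≤ q k
    q≥2 {k} 3≤k k≤n = proj₁ (proj₂ (proj₂ nl) k 3≤k k≤n)

    q-suc≤ : ∀ {j} → 3 ≤ suc j → suc j ≤ n → q (suc j) ≤ 1 + q j
    q-suc≤ {j} 3≤sj sj≤n = subst (q (suc j) ≤_) (+-comm (q j) 1) (proj₂ (proj₂ (proj₂ nl) (suc j) 3≤sj sj≤n))

  bIdx≤ : ∀ {k} → 3 ≤ k → k ≤ n → bIdx q k ≤ k
  bIdx≤ {k} 3≤k k≤n =
    subst (bIdx q k ≤_) (m+n∸n≡m k 1) (∸-monoʳ-≤ (k + 1) (≤-trans (s≤s z≤n) (q≥2 3≤k k≤n)))

  bIdx-suc-mono : ∀ {j} → 3 ≤ j → suc j ≤ n → bIdx q j ≤ bIdx q (suc j)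
  bIdx-suc-mono {j} 3≤j sj≤n =
    ∸-monoʳ-≤ (suc j + 1) (q-suc≤ (m≤n⇒m≤1+n 3≤j) sj≤n)

  bIdx-mono : ∀ {j k} → 3 ≤ j → j ≤′ k → k ≤ n → bIdx q j ≤ bIdx q k
  bIdx-mono 3≤j ≤′-refl k≤n = ≤-refl
  bIdx-mono 3≤j (≤′-step j≤k) sk≤n =
    ≤-trans (bIdx-mono 3≤j j≤k (<⇒≤ sk≤n)) (bIdx-suc-mono (≤-trans 3≤j (≤′⇒≤ j≤k)) sk≤n)

  module _ {a : ℕ → ℕ} (ns : IsNeighborhoodSeq n q a) where

    InW⇒< : ∀ {y x} → y ≤ n → InW q a y x → x < y
    InW⇒< {suc (suc zero)} _ refl = s≤s (s≤s z≤n)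
    InW⇒< {y@(suc (suc (suc _)))} y≤n (inj₁ refl) =
      <-≤-trans (proj₂ (ns y (s≤s (s≤s (s≤s z≤n))) y≤n)) (bIdx≤ (s≤s (s≤s (s≤s z≤n))) y≤n)
    InW⇒< {suc (suc (suc _))} _ (inj₂ (_ , x<y)) = x<y

    InW-descend : ∀ {v y x} → 2 ≤ v → 1 ≤ x → x < v → v ≤′ y → y ≤ n →
                  InW q a y x → InW q a v x
    InW-descend 2≤v 1≤x x<v ≤′-refl y≤n x∈W = x∈W
    InW-descend 2≤v 1≤x x<v (≤′-step {y} v≤y) sy≤n x∈W
      with InW-unfold (s≤s (≤-trans 2≤v (≤′⇒≤ v≤y))) x∈W
    ... | inj₁ refl =
      InW-descend 2≤v 1≤x x<v v≤y (<⇒≤ sy≤n) (proj₁ (ns (suc y) (s≤s (≤-trans 2≤v (≤′⇒≤ v≤y))) sy≤n))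
    ... | inj₂ (b≤x , _) =
      InW-fromInterval 2≤v 1≤x x<v (λ 3≤v → ≤-trans (bIdx-mono 3≤v (≤′-step v≤y) sy≤n) b≤x)

    module _ {v : ℕ} (2≤v : 2 ≤ v) (v≤n : v ≤ n) where

      InW-⊓ : ∀ {x y} → 1 ≤ x → y ≤ n → InW q a y x → x ⊓ v ≡ y ⊓ v ⊎ InW q a (y ⊓ v) (x ⊓ v)
      InW-⊓ {x} {y} 1≤x y≤n x∈W with y ≤? v
      ... | yes y≤v
        rewrite m≤n⇒m⊓n≡m y≤v | m≤n⇒m⊓n≡m (<⇒≤ (<-≤-trans (InW⇒< y≤n x∈W) y≤v)) = inj₂ x∈W
      ... | no y≰v with x <? v
      ...   | yes x<v rewrite m≥n⇒m⊓n≡n (<⇒≤ (≰⇒> y≰v)) | m≤n⇒m⊓n≡m (<⇒≤ x<v) =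
        inj₂ (InW-descend 2≤v 1≤x x<v (≤⇒≤′ (<⇒≤ (≰⇒> y≰v))) y≤n x∈W)
      ...   | no x≮v rewrite m≥n⇒m⊓n≡n (<⇒≤ (≰⇒> y≰v)) | m≥n⇒m⊓n≡n (≮⇒≥ x≮v) = inj₁ refl

      private
        1≤⊓ : ∀ {z} → 1 ≤ z → 1 ≤ z ⊓ v
        1≤⊓ 1≤z = ⊓-glb 1≤z (≤-trans (s≤s z≤n) 2≤v)

        ⊓≤n : ∀ z → z ⊓ v ≤ n
        ⊓≤n z = ≤-trans (m⊓n≤n z v) v≤n

      Adj-⊓ : ∀ {x y} → Adj n q a x y → x ⊓ v ≡ y ⊓ v ⊎ Adj n q a (x ⊓ v) (y ⊓ v)
      Adj-⊓ {x} {y} (1≤x , x≤n , 1≤y , y≤n , inj₁ x∈Wy) =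
        map₂ (λ e → 1≤⊓ 1≤x , ⊓≤n x , 1≤⊓ 1≤y , ⊓≤n y , inj₁ e) (InW-⊓ 1≤x y≤n x∈Wy)
      Adj-⊓ {x} {y} (1≤x , x≤n , 1≤y , y≤n , inj₂ y∈Wx) =
        map sym (λ e → 1≤⊓ 1≤x , ⊓≤n x , 1≤⊓ 1≤y , ⊓≤n y , inj₂ e) (InW-⊓ 1≤y x≤n y∈Wx)

corollary2p9 : (n : ℕ) → 2 ≤ n → (q a : ℕ → ℕ) →
    NonLeaping n q → IsNeighborhoodSeq n q a →
    (u v : ℕ) → 1 ≤ u → u < v → v ≤ n →
    (l : ℕ) (w : Walk (Adj n q a) u v l) → IsShortest w →
    (k : ℕ) → OnWalk k w → k ≤ v
corollary2p9 n _ q a nl ns u v 1≤u u<v v≤n l w shortest k k∈w with k ≤? v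
... | yes k≤v = k≤v
... | no k≰v with walk-prefix k∈w
...   | _ , _ , inj₂ refl = ⊥-elim (k≰v ≤-refl)
...   | l₁ , u→k , inj₁ l₁<l
  with walk-map (_⊓ v) (Adj-⊓ nl ns (<-≤-trans (s≤s 1≤u) u<v) v≤n) u→k
...   | l′ , l′≤l₁ , u→v
  rewrite m≤n⇒m⊓n≡m (<⇒≤ u<v) | m≥n⇒m⊓n≡n (<⇒≤ (≰⇒> k≰v)) =
  ⊥-elim (<⇒≱ (≤-<-trans l′≤l₁ l₁<l) (shortest l′ u→v))
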